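{- For $n\ge 7$, the cycle $C_n$ on $n$ vertices satisfies $$\mathrm{ID}(C_n,x)=2x\,\mathrm{ID}(P_{n-3},x)+x^2\,\mathrm{ID}(P_{n-6},x),$$ where $P_m$ denotes the path on $m$ vertices and $P_0$ is the graph with no vertices, with $\mathrm{ID}(P_0,x)=1$.
   Context: A set $W\subseteq V$ is an independent dominating set of a graph $G=(V,E)$ if every vertex of $V\setminus W$ is adjacent to at least one vertex of $W$ and no two vertices of $W$ are adjacent. The independent domination polynomial is $\mathrm{ID}(G,x)=\sum_{W}x^{|W|}$, the sum over all independent dominating sets $W$ of $G$. -}

module Defs where

open import Data.Nat using (ℕ; zero; suc; _+_; _*_; _∸_; _≡ᵇ_)
open import Data.Nat.DivMod using (_%_)
open import Data.Bool using (Bool; true; false; _∧_; _∨_; not; if_then_else_)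
open import Data.Fin using (Fin; toℕ)
open import Data.Vec using (Vec; []; _∷_; lookup)
open import Data.List using (List; []; _∷_; map; _++_; length; filter; allFin)
open import Data.Bool.ListAction using (any; all)
open import Relation.Binary.PropositionalEquality using (_≡_)

-- A (finite simple) graph on vertex set Fin n, given by a Bool-valued
-- adjacency relation (all graphs used below are symmetric and loopless).
Graph : ℕ → Set
Graph n = Fin n → Fin n → Bool

path : (m : ℕ) → Graph m
path m i j = (suc (toℕ i) ≡ᵇ toℕ j) ∨ (suc (toℕ j) ≡ᵇ toℕ i)

-- Cycle C_n on vertices 0..n-1 : i ~ j iff j ≡ i+1 or i ≡ j+1 (mod n).
-- (Used for n ≥ 3, where this is the usual simple cycle.)
cycle : (n : ℕ) → Graph n
cycle zero ()
cycle (suc k) i j =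
  ((suc (toℕ i) % suc k) ≡ᵇ toℕ j) ∨ ((suc (toℕ j) % suc k) ≡ᵇ toℕ i)

-- Subsets of Fin n as characteristic vectors; list of all 2^n subsets.
Subset : ℕ → Set
Subset n = Vec Bool n

allSubsets : (n : ℕ) → List (Subset n)
allSubsets zero = [] ∷ []
allSubsets (suc n) = map (true ∷_) (allSubsets n) ++ map (false ∷_) (allSubsets n)

size : ∀ {n} → Subset n → ℕ
size [] = 0
size (true ∷ w) = suc (size w)
size (false ∷ w) = size w

independent : ∀ {n} → Graph n → Subset n → Bool
independent {n} G W =
  all (λ u → all (λ v → not (lookup W u ∧ lookup W v ∧ G u v)) (allFin n)) (allFin n)

dominating : ∀ {n} → Graph n → Subset n → Bool
dominating {n} G W =
  all (λ v → lookup W v ∨ any (λ u → lookup W u ∧ G u v) (allFin n)) (allFin n)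

isIDS : ∀ {n} → Graph n → Subset n → Bool
isIDS G W = independent G W ∧ dominating G W

-- Polynomials with ℕ coefficients, as coefficient sequences.
Poly : Set
Poly = ℕ → ℕ

_+ₚ_ : Poly → Poly → Poly
(p +ₚ q) k = p k + q k

_·ₚ_ : ℕ → Poly → Poly
(c ·ₚ p) k = c * p k

xₚ* : Poly → Poly
xₚ* p zero = 0
xₚ* p (suc k) = p k

_≈ₚ_ : Poly → Poly → Set
p ≈ₚ q = ∀ k → p k ≡ q k

count : ∀ {A : Set} → (A → Bool) → List A → ℕ
count P [] = 0
count P (a ∷ as) = if P a then suc (count P as) else count P as

ID : ∀ {n} → Graph n → Poly
ID {n} G k = count (λ W → isIDS G W ∧ (size W ≡ᵇ k)) (allSubsets n)

-- A subset W of a path or cycle is a Boolean word, and being an independent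
-- dominating set is a condition on each vertex and its two neighbours
-- (vertexOK): a member has no neighbour in W, a non-member has one.  Finally, splitting the IDSs of C_(6+r) by the
-- membership of vertices 0 and 1 gives three classes: 0 ∈ W (a path P_(3+r)
-- on 2 … n-2), 0 ∉ W ∋ 1 (a path P_(3+r) on 3 … n-1), and 0, 1 ∉ W, which
-- forces 2, n-1 ∈ W and leaves a path P_r on 4 … n-3.  Each identification is a
-- short computation of locallyIDS on the fixed letters.

module Submission where

open import Defs
open import Data.Nat using (ℕ; _≤_; _∸_)
open import Data.Nat.Base using (zero; suc; _+_; _*_; _<_; _≡ᵇ_; s≤s; z≤n)
open import Data.Nat.Properties using (≡ᵇ⇒≡; ≡⇒≡ᵇ; suc-injective; +-identityʳ; +-assoc; +-commutativeSemigroup; m<1+n⇒m<n∨m≡n)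
open import Algebra.Properties.CommutativeSemigroup +-commutativeSemigroup using () renaming (interchange to +-interchange)
open import Data.Nat.DivMod using (_%_; m<n⇒m%n≡m; n%n≡0)
open import Data.Bool.Base using (Bool; true; false; _∧_; _∨_; not; if_then_else_; T)
open import Data.Bool.Properties using (T-∧; T-∨; T-≡; ⇔→≡; ∧-zeroʳ; ∨-zeroʳ; ∧-identityʳ; ∧-assoc)
open import Data.Unit using (tt)
open import Data.Empty using (⊥)
open import Data.Fin.Base using (Fin; toℕ) renaming (zero to fzero; suc to fsuc)
open import Data.Fin.Properties using (toℕ<n)
open import Data.Vec.Base using (Vec; []; _∷_; lookup; _∷ʳ_)
open import Data.List.Base using ([]; _∷_; map; _++_; allFin)
open import Data.Bool.ListAction using (any; all)
import Data.List.Relation.Unary.All.Properties as All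
import Data.List.Relation.Unary.Any.Properties as Any
open import Data.Product.Base using (∃; _×_; _,_; proj₁; proj₂)
open import Data.Sum.Base using (_⊎_; inj₁; inj₂) renaming (map to map⊎)
open import Function.Base using (_∘_)
open import Function.Bundles using (_⇔_; mk⇔; Equivalence)
import Function.Properties.Equivalence as ⇔
open import Relation.Nullary using (¬_)
open import Relation.Binary.PropositionalEquality using (_≡_; refl; sym; trans; cong; cong₂; subst; module ≡-Reasoning)

open Equivalence using (to; from)

T-⇔→≡ : ∀ {a b} → (T a ⇔ T b) → a ≡ b
T-⇔→≡ a⇔b = ⇔→≡ (⇔.trans (⇔.sym T-≡) (⇔.trans a⇔b T-≡))

T-not : ∀ {a} → T (not a) ⇔ (¬ T a)
T-not {true}  = mk⇔ (λ ()) (λ ¬t → ¬t tt)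
T-not {false} = mk⇔ (λ _ ()) (λ _ → tt)

all-allFin : ∀ {n} (p : Fin n → Bool) → T (all p (allFin n)) ⇔ (∀ v → T (p v))
all-allFin p = mk⇔ (λ h → All.tabulate⁻ (All.all⁺ p _ h)) (λ h → All.all⁻ p (All.tabulate⁺ h))

any-allFin : ∀ {n} (p : Fin n → Bool) → T (any p (allFin n)) ⇔ (∃ λ v → T (p v))
any-allFin p = mk⇔ (λ h → Any.tabulate⁻ (Any.any⁻ p _ h)) (λ (v , pv) → Any.any⁺ p (Any.tabulate⁺ v pv))

HasNeighbourIn : ∀ {n} → Graph n → Subset n → Fin n → Set
HasNeighbourIn G W v = ∃ λ u → T (lookup W u) × T (G u v)

IDSAt : ∀ {n} → Graph n → Subset n → Fin n → Set
IDSAt G W v = if lookup W v then ¬ HasNeighbourIn G W v else HasNeighbourIn G W v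

isIDS⇔IDSAt : ∀ {n} (G : Graph n) (W : Subset n) → T (isIDS G W) ⇔ (∀ v → IDSAt G W v)
isIDS⇔IDSAt {n} G W = mk⇔ ids⇒ ids⇐
  where
  notAll3 : ∀ {a b c} → T (not (a ∧ b ∧ c)) → T a → T b → T c → ⊥
  notAll3 h ta tb tc = to T-not h (from T-∧ (ta , from T-∧ (tb , tc)))

  ids⇒ : T (isIDS G W) → ∀ v → IDSAt G W v
  ids⇒ h v = atV (to (all-allFin _) (proj₂ (to T-∧ h)) v)
    where
    apart : ∀ u → T (not (lookup W u ∧ lookup W v ∧ G u v))
    apart u = to (all-allFin _) (to (all-allFin _) (proj₁ (to T-∧ h)) u) v
    atV : T (lookup W v ∨ any (λ u → lookup W u ∧ G u v) (allFin n)) → IDSAt G W v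
    atV d with lookup W v in eq
    ... | true  = λ (u , wu , g) → notAll3 (apart u) wu (subst T (sym eq) tt) g
    ... | false with to (any-allFin _) d
    ...   | u , q = u , to T-∧ q

  ids⇐ : (∀ v → IDSAt G W v) → T (isIDS G W)
  ids⇐ h = from T-∧ (from (all-allFin _) apart , from (all-allFin _) dominated)
    where
    isolated : ∀ {v} → IDSAt G W v → T (lookup W v) → ¬ HasNeighbourIn G W v
    isolated {v} c wv with lookup W v
    ... | true = c
    apart : ∀ u → T (all (λ v → not (lookup W u ∧ lookup W v ∧ G u v)) (allFin n))
    apart u = from (all-allFin _) λ v → from T-not λ t →
      let wu , t′ = to T-∧ t ; wv , g = to T-∧ t′ in isolated (h v) wv (u , wu , g)
    dominatedAt : ∀ {v} → IDSAt G W v → T (lookup W v ∨ any (λ u → lookup W u ∧ G u v) (allFin n))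
    dominatedAt {v} c with lookup W v
    ... | true  = tt
    ... | false = let u , wu , g = c in from (any-allFin _) (u , from T-∧ (wu , g))
    dominated : ∀ v → T (lookup W v ∨ any (λ u → lookup W u ∧ G u v) (allFin n))
    dominated v = dominatedAt (h v)

-- The condition at a vertex in Boolean form, from the membership of its
-- left neighbour, of itself and of its right neighbour.
vertexOK : Bool → Bool → Bool → Bool
vertexOK l true  r = not (l ∨ r)
vertexOK l false r = l ∨ r

vertexOK⇔IDSAt : ∀ b {l r} {N : Set} → N ⇔ T (l ∨ r) → T (vertexOK l b r) ⇔ (if b then ¬ N else N)
vertexOK⇔IDSAt true  N⇔ = ⇔.trans T-not (mk⇔ (λ ¬lr n → ¬lr (to N⇔ n)) (λ ¬n lr → ¬n (from N⇔ lr)))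
vertexOK⇔IDSAt false N⇔ = ⇔.sym N⇔

isIDS-vertexwise : ∀ {n} (G : Graph n) (W : Subset n) (L R : Fin n → Bool) →
  (∀ v → HasNeighbourIn G W v ⇔ T (L v ∨ R v)) →
  T (isIDS G W) ⇔ (∀ v → T (vertexOK (L v) (lookup W v) (R v)))
isIDS-vertexwise G W L R nbrs = ⇔.trans (isIDS⇔IDSAt G W)
  (mk⇔ (λ h v → from (vertexOK⇔IDSAt (lookup W v) (nbrs v)) (h v))
       (λ h v → to (vertexOK⇔IDSAt (lookup W v) (nbrs v)) (h v)))

-- The letter of a word at an index, `false` beyond its end.
at : ∀ {m} → Vec Bool m → ℕ → Bool
at []      _       = false
at (b ∷ w) zero    = b
at (b ∷ w) (suc i) = at w i

member⇔at : ∀ {m} (w : Vec Bool m) i → (∃ λ u → T (lookup w u) × toℕ u ≡ i) ⇔ T (at w i)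
member⇔at []      i = mk⇔ (λ ()) (λ ())
member⇔at (b ∷ w) zero = mk⇔ (λ { (fzero , t , _) → t }) (λ t → fzero , t , refl)
member⇔at (b ∷ w) (suc i) = mk⇔
  (λ { (fsuc u , t , e) → to (member⇔at w i) (u , t , suc-injective e) })
  (λ t → let u , t′ , e = from (member⇔at w i) t in fsuc u , t′ , cong suc e)

at-∷ʳ-last : ∀ {m} (w : Vec Bool m) b → at (w ∷ʳ b) m ≡ b
at-∷ʳ-last []      b = refl
at-∷ʳ-last (_ ∷ w) b = at-∷ʳ-last w b

at-∷ʳ-false : ∀ {m} (w : Vec Bool m) i → at (w ∷ʳ false) i ≡ at w i
at-∷ʳ-false []      zero    = refl
at-∷ʳ-false []      (suc i) = refl
at-∷ʳ-false (_ ∷ w) zero    = refl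
at-∷ʳ-false (_ ∷ w) (suc i) = at-∷ʳ-false w i

at-∷ʳ-head : ∀ {m} (w : Vec Bool (suc m)) b → at (w ∷ʳ b) 0 ≡ at w 0
at-∷ʳ-head (_ ∷ _) b = refl

at-∷ʳ-inside : ∀ {m} (w : Vec Bool m) b {i} → i < m → at (w ∷ʳ b) i ≡ at w i
at-∷ʳ-inside (_ ∷ w) b {zero}  _       = refl
at-∷ʳ-inside (_ ∷ w) b {suc i} (s≤s p) = at-∷ʳ-inside w b p

-- `locallyIDS ℓ w r`: every letter of w satisfies vertexOK with its
-- neighbours in the word ℓ w r (the flanks ℓ, r are not checked themselves).
locallyIDS : ∀ {m} → Bool → Vec Bool m → Bool → Bool
locallyIDS ℓ []      r = true
locallyIDS ℓ (a ∷ w) r = vertexOK ℓ a (at (w ∷ʳ r) 0) ∧ locallyIDS a w r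

locallyIDS-vertexwise : ∀ {m} ℓ (w : Vec Bool m) r →
  T (locallyIDS ℓ w r) ⇔
  (∀ v → T (vertexOK (at (ℓ ∷ w) (toℕ v)) (lookup w v) (at (w ∷ʳ r) (suc (toℕ v)))))
locallyIDS-vertexwise ℓ []      r = mk⇔ (λ _ ()) (λ _ → tt)
locallyIDS-vertexwise ℓ (a ∷ w) r = mk⇔
  (λ t → let here , rest = to T-∧ t in λ { fzero → here ; (fsuc v) → to (locallyIDS-vertexwise a w r) rest v })
  (λ h → from T-∧ (h fzero , from (locallyIDS-vertexwise a w r) (h ∘ fsuc)))

member⇔at-false∷ : ∀ {m} (w : Vec Bool m) i →
  (∃ λ u → T (lookup w u) × suc (toℕ u) ≡ i) ⇔ T (at (false ∷ w) i)
member⇔at-false∷ w zero    = mk⇔ (λ { (_ , _ , ()) }) (λ ())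
member⇔at-false∷ w (suc i) = mk⇔
  (λ (u , t , e) → to (member⇔at w i) (u , t , suc-injective e))
  (λ t → let u , t′ , e = from (member⇔at w i) t in u , t′ , cong suc e)

neighbours-by-index : ∀ {n} (G : Graph n) (w : Subset n) v a b →
  (∀ u → T (G u v) ⇔ (suc (toℕ u) ≡ a ⊎ toℕ u ≡ b)) →
  HasNeighbourIn G w v ⇔ T (at (false ∷ w) a ∨ at w b)
neighbours-by-index G w v a b adj = mk⇔ nbr⇒ nbr⇐
  where
  nbr⇒ : HasNeighbourIn G w v → T (at (false ∷ w) a ∨ at w b)
  nbr⇒ (u , t , g) with to (adj u) g
  ... | inj₁ e = from T-∨ (inj₁ (to (member⇔at-false∷ w a) (u , t , e)))
  ... | inj₂ e = from T-∨ (inj₂ (to (member⇔at w b) (u , t , e)))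
  nbr⇐ : T (at (false ∷ w) a ∨ at w b) → HasNeighbourIn G w v
  nbr⇐ t with to T-∨ t
  ... | inj₁ l = let u , t′ , e = from (member⇔at-false∷ w a) l in u , t′ , from (adj u) (inj₁ e)
  ... | inj₂ r = let u , t′ , e = from (member⇔at w b) r in u , t′ , from (adj u) (inj₂ e)

path-adjacent : ∀ {m} (u v : Fin m) →
  T (path m u v) ⇔ (suc (toℕ u) ≡ toℕ v ⊎ toℕ u ≡ suc (toℕ v))
path-adjacent u v = ⇔.trans T-∨
  (mk⇔ (map⊎ (≡ᵇ⇒≡ _ _) (sym ∘ ≡ᵇ⇒≡ _ _)) (map⊎ (≡⇒≡ᵇ _ _) (≡⇒≡ᵇ _ _ ∘ sym)))

path-isIDS : ∀ {m} (w : Subset m) → isIDS (path m) w ≡ locallyIDS false w false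
path-isIDS {m} w = T-⇔→≡ (⇔.trans
  (isIDS-vertexwise (path m) w _ _ neighbours)
  (⇔.sym (locallyIDS-vertexwise false w false)))
  where
  neighbours : ∀ v → HasNeighbourIn (path m) w v ⇔ T (at (false ∷ w) (toℕ v) ∨ at (w ∷ʳ false) (suc (toℕ v)))
  neighbours v = subst (λ x → HasNeighbourIn (path m) w v ⇔ T (at (false ∷ w) (toℕ v) ∨ x))
    (sym (at-∷ʳ-false w (suc (toℕ v))))
    (neighbours-by-index (path m) w v (toℕ v) (suc (toℕ v)) (λ u → path-adjacent u v))

predOnCycle : ℕ → ℕ → ℕ
predOnCycle k zero    = k
predOnCycle k (suc j) = j

succ-mod⇔pred : ∀ k {u v} → u < suc k → v < suc k → (suc u % suc k ≡ v) ⇔ (u ≡ predOnCycle k v)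
succ-mod⇔pred k {u} {v} u<n v<n = mk⇔ mod⇒ (mod⇐ v v<n)
  where
  mod⇒ : suc u % suc k ≡ v → u ≡ predOnCycle k v
  mod⇒ e with m<1+n⇒m<n∨m≡n u<n
  ... | inj₁ u<k = cong (predOnCycle k) (trans (sym (m<n⇒m%n≡m (s≤s u<k))) e)
  ... | inj₂ refl = cong (predOnCycle k) (trans (sym (n%n≡0 (suc k))) e)
  mod⇐ : ∀ v → v < suc k → u ≡ predOnCycle k v → suc u % suc k ≡ v
  mod⇐ zero    _   refl = n%n≡0 (suc k)
  mod⇐ (suc j) v<n refl = m<n⇒m%n≡m v<n

cycle-adjacent : ∀ {k} (u v : Fin (suc k)) →
  T (cycle (suc k) u v) ⇔ (suc (toℕ u) ≡ suc (predOnCycle k (toℕ v)) ⊎ toℕ u ≡ suc (toℕ v) % suc k)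
cycle-adjacent {k} u v = ⇔.trans T-∨ (mk⇔
  (map⊎ (λ t → cong suc (to (succ-mod⇔pred k (toℕ<n u) (toℕ<n v)) (≡ᵇ⇒≡ _ _ t))) (sym ∘ ≡ᵇ⇒≡ _ _))
  (map⊎ (λ e → ≡⇒≡ᵇ _ _ (from (succ-mod⇔pred k (toℕ<n u) (toℕ<n v)) (suc-injective e))) (≡⇒≡ᵇ _ _ ∘ sym)))

at-cyclic-left : ∀ {k} (w : Vec Bool (suc k)) i → at (at w k ∷ w) i ≡ at (false ∷ w) (suc (predOnCycle k i))
at-cyclic-left w zero    = refl
at-cyclic-left w (suc i) = refl

at-cyclic-right : ∀ {k} (w : Vec Bool (suc k)) {v} → v < suc k → at (w ∷ʳ at w 0) (suc v) ≡ at w (suc v % suc k)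
at-cyclic-right {k} w {v} v<n with m<1+n⇒m<n∨m≡n v<n
... | inj₁ v<k  = trans (at-∷ʳ-inside w (at w 0) (s≤s v<k)) (cong (at w) (sym (m<n⇒m%n≡m (s≤s v<k))))
... | inj₂ refl = trans (at-∷ʳ-last w (at w 0)) (cong (at w) (sym (n%n≡0 (suc k))))

cycleOK : ∀ {k} → Subset (suc k) → Bool
cycleOK {k} w = locallyIDS (at w k) w (at w 0)

cycle-isIDS : ∀ {k} (w : Subset (suc k)) → isIDS (cycle (suc k)) w ≡ cycleOK w
cycle-isIDS {k} w = T-⇔→≡ (⇔.trans
  (isIDS-vertexwise (cycle (suc k)) w _ _ neighbours)
  (⇔.sym (locallyIDS-vertexwise (at w k) w (at w 0))))
  where
  neighbours : ∀ v → HasNeighbourIn (cycle (suc k)) w v ⇔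
    T (at (at w k ∷ w) (toℕ v) ∨ at (w ∷ʳ at w 0) (suc (toℕ v)))
  neighbours v = subst (λ x → HasNeighbourIn (cycle (suc k)) w v ⇔ T x)
    (sym (cong₂ _∨_ (at-cyclic-left w (toℕ v)) (at-cyclic-right w (toℕ<n v))))
    (neighbours-by-index (cycle (suc k)) w v _ _ (λ u → cycle-adjacent u v))

locallyIDS-∷ʳ : ∀ {m} ℓ (w : Vec Bool m) a r →
  locallyIDS ℓ (w ∷ʳ a) r ≡ locallyIDS ℓ w a ∧ vertexOK (at (ℓ ∷ w) m) a r
locallyIDS-∷ʳ ℓ []      a r = ∧-identityʳ (vertexOK ℓ a r)
locallyIDS-∷ʳ {suc m} ℓ (b ∷ w) a r = begin
  vertexOK ℓ b (at ((w ∷ʳ a) ∷ʳ r) 0) ∧ locallyIDS b (w ∷ʳ a) r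
    ≡⟨ cong₂ _∧_ (cong (vertexOK ℓ b) (at-∷ʳ-head (w ∷ʳ a) r)) (locallyIDS-∷ʳ b w a r) ⟩
  vertexOK ℓ b (at (w ∷ʳ a) 0) ∧ (locallyIDS b w a ∧ vertexOK (at (b ∷ w) m) a r)
    ≡⟨ sym (∧-assoc (vertexOK ℓ b (at (w ∷ʳ a) 0)) _ _) ⟩
  (vertexOK ℓ b (at (w ∷ʳ a) 0) ∧ locallyIDS b w a) ∧ vertexOK (at (b ∷ w) m) a r ∎
  where open ≡-Reasoning

locallyIDS-∷-false : ∀ {m} ℓ a (w : Vec Bool m) r → locallyIDS a w r ≡ false → locallyIDS ℓ (a ∷ w) r ≡ false
locallyIDS-∷-false ℓ a w r h = trans (cong (vertexOK ℓ a (at (w ∷ʳ r) 0) ∧_) h) (∧-zeroʳ _)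

adjacent-members : ∀ {m} ℓ (x : Vec Bool m) r → locallyIDS ℓ (true ∷ true ∷ x) r ≡ false
adjacent-members ℓ x r rewrite ∨-zeroʳ ℓ = refl

adjacent-members-at-end : ∀ {m} ℓ (v : Vec Bool m) r → locallyIDS ℓ ((v ∷ʳ true) ∷ʳ true) r ≡ false
adjacent-members-at-end ℓ v r
  rewrite locallyIDS-∷ʳ ℓ (v ∷ʳ true) true r | at-∷ʳ-last v true = ∧-zeroʳ _

undominated : ∀ {m} (x : Vec Bool m) r → locallyIDS false (false ∷ false ∷ x) r ≡ false
undominated x r = refl

dominated-by-right-flank : ∀ {m} ℓ (w : Vec Bool m) → locallyIDS ℓ (w ∷ʳ false) true ≡ locallyIDS ℓ w false
dominated-by-right-flank {m} ℓ w
  rewrite locallyIDS-∷ʳ ℓ w false true | ∨-zeroʳ (at (ℓ ∷ w) m) = ∧-identityʳ _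

append-nonmember-member : ∀ {m} ℓ (w : Vec Bool m) → locallyIDS ℓ ((w ∷ʳ false) ∷ʳ true) false ≡ locallyIDS ℓ w false
append-nonmember-member ℓ w
  rewrite locallyIDS-∷ʳ ℓ (w ∷ʳ false) true false | at-∷ʳ-last w false
  = trans (∧-identityʳ _) (dominated-by-right-flank ℓ w)

count-++ : ∀ {A : Set} (P : A → Bool) xs ys → count P (xs ++ ys) ≡ count P xs + count P ys
count-++ P []       ys = refl
count-++ P (x ∷ xs) ys with P x
... | true  = cong suc (count-++ P xs ys)
... | false = count-++ P xs ys

count-map : ∀ {A B : Set} (P : B → Bool) (f : A → B) xs → count P (map f xs) ≡ count (P ∘ f) xs
count-map P f []       = refl
count-map P f (x ∷ xs) with P (f x)
... | true  = cong suc (count-map P f xs)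
... | false = count-map P f xs

count-ext : ∀ {A : Set} {P Q : A → Bool} → (∀ x → P x ≡ Q x) → ∀ xs → count P xs ≡ count Q xs
count-ext P≗Q []       = refl
count-ext {Q = Q} P≗Q (x ∷ xs) rewrite P≗Q x = cong (λ c → if Q x then suc c else c) (count-ext P≗Q xs)

count-none : ∀ {A : Set} {P : A → Bool} → (∀ x → P x ≡ false) → ∀ xs → count P xs ≡ 0
count-none none []       = refl
count-none none (x ∷ xs) rewrite none x = count-none none xs

count-∷ : ∀ {m} (P : Subset (suc m) → Bool) →
  count P (allSubsets (suc m)) ≡ count (λ W → P (true ∷ W)) (allSubsets m) + count (λ W → P (false ∷ W)) (allSubsets m)
count-∷ {m} P = trans (count-++ P (map (true ∷_) (allSubsets m)) (map (false ∷_) (allSubsets m)))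
  (cong₂ _+_ (count-map P (true ∷_) (allSubsets m)) (count-map P (false ∷_) (allSubsets m)))

count-∷ʳ : ∀ {m} (P : Subset (suc m) → Bool) →
  count P (allSubsets (suc m)) ≡ count (λ W → P (W ∷ʳ true)) (allSubsets m) + count (λ W → P (W ∷ʳ false)) (allSubsets m)
count-∷ʳ {zero}  P = count-∷ P
count-∷ʳ {suc m} P = begin
  count P (allSubsets (2 + m))
    ≡⟨ count-∷ P ⟩
  count (λ W → P (true ∷ W)) (allSubsets (suc m)) + count (λ W → P (false ∷ W)) (allSubsets (suc m))
    ≡⟨ cong₂ _+_ (count-∷ʳ (λ W → P (true ∷ W))) (count-∷ʳ (λ W → P (false ∷ W))) ⟩
  (c true true + c true false) + (c false true + c false false)
    ≡⟨ +-interchange (c true true) (c true false) (c false true) (c false false) ⟩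
  (c true true + c false true) + (c true false + c false false)
    ≡⟨ sym (cong₂ _+_ (count-∷ (λ W → P (W ∷ʳ true))) (count-∷ (λ W → P (W ∷ʳ false)))) ⟩
  count (λ W → P (W ∷ʳ true)) (allSubsets (suc m)) + count (λ W → P (W ∷ʳ false)) (allSubsets (suc m)) ∎
  where
  open ≡-Reasoning
  c : Bool → Bool → ℕ
  c first last = count (λ W → P (first ∷ (W ∷ʳ last))) (allSubsets m)

size-∷ʳ-true : ∀ {m} (W : Subset m) → size (W ∷ʳ true) ≡ suc (size W)
size-∷ʳ-true []          = refl
size-∷ʳ-true (true ∷ W)  = cong suc (size-∷ʳ-true W)
size-∷ʳ-true (false ∷ W) = size-∷ʳ-true W

size-∷ʳ-false : ∀ {m} (W : Subset m) → size (W ∷ʳ false) ≡ size W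
size-∷ʳ-false []          = refl
size-∷ʳ-false (true ∷ W)  = cong suc (size-∷ʳ-false W)
size-∷ʳ-false (false ∷ W) = size-∷ʳ-false W

sizePoly : (m : ℕ) → (Subset m → Bool) → Poly
sizePoly m P k = count (λ W → P W ∧ (size W ≡ᵇ k)) (allSubsets m)

sizePoly-ext : ∀ {m} {P Q : Subset m → Bool} → (∀ W → P W ≡ Q W) → sizePoly m P ≈ₚ sizePoly m Q
sizePoly-ext {m} P≗Q k = count-ext (λ W → cong (_∧ (size W ≡ᵇ k)) (P≗Q W)) (allSubsets m)

sizePoly-none : ∀ {m} {P : Subset m → Bool} → (∀ W → P W ≡ false) → ∀ k → sizePoly m P k ≡ 0
sizePoly-none {m} none k = count-none (λ W → cong (_∧ (size W ≡ᵇ k)) (none W)) (allSubsets m)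

sizePoly-split : ∀ {m} (P : Subset (suc m) → Bool) (insert omit : Subset m → Subset (suc m)) →
  (∀ Q → count Q (allSubsets (suc m)) ≡ count (Q ∘ insert) (allSubsets m) + count (Q ∘ omit) (allSubsets m)) →
  (∀ W → size (insert W) ≡ suc (size W)) → (∀ W → size (omit W) ≡ size W) →
  sizePoly (suc m) P ≈ₚ (xₚ* (sizePoly m (P ∘ insert)) +ₚ sizePoly m (P ∘ omit))
sizePoly-split {m} P insert omit split size-insert size-omit k =
  trans (split (λ W → P W ∧ (size W ≡ᵇ k))) (cong₂ _+_ (inserted k) omitted)
  where
  inserted : ∀ k → count (λ W → P (insert W) ∧ (size (insert W) ≡ᵇ k)) (allSubsets m) ≡ xₚ* (sizePoly m (P ∘ insert)) k
  inserted zero    = count-none (λ W → trans (cong (λ s → P (insert W) ∧ (s ≡ᵇ 0)) (size-insert W)) (∧-zeroʳ _)) (allSubsets m)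
  inserted (suc k) = count-ext (λ W → cong (λ s → P (insert W) ∧ (s ≡ᵇ suc k)) (size-insert W)) (allSubsets m)
  omitted : count (λ W → P (omit W) ∧ (size (omit W) ≡ᵇ k)) (allSubsets m) ≡ sizePoly m (P ∘ omit) k
  omitted = count-ext (λ W → cong (λ s → P (omit W) ∧ (s ≡ᵇ k)) (size-omit W)) (allSubsets m)

sizePoly-∷ : ∀ m (P : Subset (suc m) → Bool) →
  sizePoly (suc m) P ≈ₚ (xₚ* (sizePoly m (λ W → P (true ∷ W))) +ₚ sizePoly m (λ W → P (false ∷ W)))
sizePoly-∷ m P = sizePoly-split P (true ∷_) (false ∷_) count-∷ (λ _ → refl) (λ _ → refl)

sizePoly-∷ʳ : ∀ m (P : Subset (suc m) → Bool) →
  sizePoly (suc m) P ≈ₚ (xₚ* (sizePoly m (λ W → P (W ∷ʳ true))) +ₚ sizePoly m (λ W → P (W ∷ʳ false)))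
sizePoly-∷ʳ m P = sizePoly-split P (_∷ʳ true) (_∷ʳ false) count-∷ʳ size-∷ʳ-true size-∷ʳ-false

xₚ*-cong : ∀ {p q} → p ≈ₚ q → xₚ* p ≈ₚ xₚ* q
xₚ*-cong p≈q zero    = refl
xₚ*-cong p≈q (suc k) = p≈q k

drop-members : ∀ {p q s} → p ≈ₚ (xₚ* q +ₚ s) → (∀ k → q k ≡ 0) → p ≈ₚ s
drop-members split q≈0 zero    = split zero
drop-members split q≈0 (suc k) = trans (split (suc k)) (cong (_+ _) (q≈0 k))

drop-nonmembers : ∀ {p q s} → p ≈ₚ (xₚ* q +ₚ s) → (∀ k → s k ≡ 0) → p ≈ₚ xₚ* q
drop-nonmembers split s≈0 k = trans (split k) (trans (cong (_ +_) (s≈0 k)) (+-identityʳ _))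

module CycleWords (r : ℕ) where

  -- vertex 0 ∈ W:  then 1, n-1 ∉ W and the rest is an IDS of the path 2 … n-2
  cycle-11 : ∀ x → cycleOK {5 + r} (true ∷ true ∷ x) ≡ false
  cycle-11 x = adjacent-members _ x true

  cycle-10-1 : ∀ u → cycleOK {5 + r} (true ∷ false ∷ (u ∷ʳ true)) ≡ false
  cycle-10-1 u rewrite at-∷ʳ-last u true = refl

  cycle-10-0 : ∀ u → cycleOK {5 + r} (true ∷ false ∷ (u ∷ʳ false)) ≡ locallyIDS false u false
  cycle-10-0 u rewrite at-∷ʳ-last u false = dominated-by-right-flank false u

  -- 0 ∉ W, 1 ∈ W:  then 2 ∉ W and the rest is an IDS of the path 3 … n-1
  cycle-011 : ∀ x → cycleOK {5 + r} (false ∷ true ∷ true ∷ x) ≡ false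
  cycle-011 x = locallyIDS-∷-false (at x (2 + r)) false (true ∷ true ∷ x) false (adjacent-members false x false)

  cycle-010 : ∀ u → cycleOK {5 + r} (false ∷ true ∷ false ∷ u) ≡ locallyIDS false u false
  cycle-010 u = cong (_∧ locallyIDS false u false) (∨-zeroʳ (at u (2 + r)))

  -- 0, 1 ∉ W:  then 2, n-1 ∈ W, so 3, n-2 ∉ W and the rest is an IDS of the path 4 … n-3
  cycle-000 : ∀ x → cycleOK {5 + r} (false ∷ false ∷ false ∷ x) ≡ false
  cycle-000 x = locallyIDS-∷-false (at x (2 + r)) false (false ∷ false ∷ x) false (undominated x false)

  cycle-0011 : ∀ x → cycleOK {5 + r} (false ∷ false ∷ true ∷ true ∷ x) ≡ false
  cycle-0011 x = locallyIDS-∷-false (at x (1 + r)) false (false ∷ true ∷ true ∷ x) false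
    (locallyIDS-∷-false false false (true ∷ true ∷ x) false (adjacent-members false x false))

  cycle-0010-0 : ∀ y → cycleOK {5 + r} (false ∷ false ∷ true ∷ false ∷ (y ∷ʳ false)) ≡ false
  cycle-0010-0 y rewrite at-∷ʳ-last y false = refl

  cycle-0010-11 : ∀ v → cycleOK {5 + r} (false ∷ false ∷ true ∷ false ∷ ((v ∷ʳ true) ∷ʳ true)) ≡ false
  cycle-0010-11 v rewrite at-∷ʳ-last (v ∷ʳ true) true = adjacent-members-at-end false v false

  cycle-0010-01 : ∀ v → cycleOK {5 + r} (false ∷ false ∷ true ∷ false ∷ ((v ∷ʳ false) ∷ʳ true)) ≡ locallyIDS false v false
  cycle-0010-01 v rewrite at-∷ʳ-last (v ∷ʳ false) true = append-nonmember-member false v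

  with-0 : sizePoly (5 + r) (λ x → cycleOK (true ∷ x)) ≈ₚ ID (path (3 + r))
  with-0 k = begin
    sizePoly (5 + r) (λ x → cycleOK (true ∷ x)) k
      ≡⟨ drop-members (sizePoly-∷ (4 + r) (λ x → cycleOK (true ∷ x))) (sizePoly-none cycle-11) k ⟩
    sizePoly (4 + r) (λ x → cycleOK (true ∷ false ∷ x)) k
      ≡⟨ drop-members (sizePoly-∷ʳ (3 + r) (λ x → cycleOK (true ∷ false ∷ x))) (sizePoly-none cycle-10-1) k ⟩
    sizePoly (3 + r) (λ u → cycleOK (true ∷ false ∷ (u ∷ʳ false))) k
      ≡⟨ sizePoly-ext (λ u → trans (cycle-10-0 u) (sym (path-isIDS u))) k ⟩
    ID (path (3 + r)) k ∎
    where open ≡-Reasoning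

  with-1 : sizePoly (4 + r) (λ x → cycleOK (false ∷ true ∷ x)) ≈ₚ ID (path (3 + r))
  with-1 k = begin
    sizePoly (4 + r) (λ x → cycleOK (false ∷ true ∷ x)) k
      ≡⟨ drop-members (sizePoly-∷ (3 + r) (λ x → cycleOK (false ∷ true ∷ x))) (sizePoly-none cycle-011) k ⟩
    sizePoly (3 + r) (λ u → cycleOK (false ∷ true ∷ false ∷ u)) k
      ≡⟨ sizePoly-ext (λ u → trans (cycle-010 u) (sym (path-isIDS u))) k ⟩
    ID (path (3 + r)) k ∎
    where open ≡-Reasoning

  without-0-1 : sizePoly (4 + r) (λ x → cycleOK (false ∷ false ∷ x)) ≈ₚ xₚ* (xₚ* (ID (path r)))
  without-0-1 k = trans (drop-nonmembers (sizePoly-∷ (3 + r) (λ x → cycleOK (false ∷ false ∷ x))) (sizePoly-none cycle-000) k) (xₚ*-cong with-2 k)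
    where
    with-2 : sizePoly (3 + r) (λ x → cycleOK (false ∷ false ∷ true ∷ x)) ≈ₚ xₚ* (ID (path r))
    with-2 k = begin
      sizePoly (3 + r) (λ x → cycleOK (false ∷ false ∷ true ∷ x)) k
        ≡⟨ drop-members (sizePoly-∷ (2 + r) (λ x → cycleOK (false ∷ false ∷ true ∷ x))) (sizePoly-none cycle-0011) k ⟩
      sizePoly (2 + r) (λ x → cycleOK (false ∷ false ∷ true ∷ false ∷ x)) k
        ≡⟨ drop-nonmembers (sizePoly-∷ʳ (1 + r) (λ x → cycleOK (false ∷ false ∷ true ∷ false ∷ x))) (sizePoly-none cycle-0010-0) k ⟩
      xₚ* (sizePoly (1 + r) (λ y → cycleOK (false ∷ false ∷ true ∷ false ∷ (y ∷ʳ true)))) k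
        ≡⟨ xₚ*-cong (drop-members (sizePoly-∷ʳ r (λ y → cycleOK (false ∷ false ∷ true ∷ false ∷ (y ∷ʳ true)))) (sizePoly-none cycle-0010-11)) k ⟩
      xₚ* (sizePoly r (λ v → cycleOK (false ∷ false ∷ true ∷ false ∷ ((v ∷ʳ false) ∷ʳ true)))) k
        ≡⟨ xₚ*-cong (sizePoly-ext (λ v → trans (cycle-0010-01 v) (sym (path-isIDS v)))) k ⟩
      xₚ* (ID (path r)) k ∎
      where open ≡-Reasoning

cycle-ID : ∀ r → ID (cycle (6 + r)) ≈ₚ ((2 ·ₚ xₚ* (ID (path (3 + r)))) +ₚ xₚ* (xₚ* (ID (path r))))
cycle-ID r k = begin
  ID (cycle (6 + r)) k
    ≡⟨ sizePoly-ext (cycle-isIDS {5 + r}) k ⟩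
  sizePoly (6 + r) cycleOK k
    ≡⟨ sizePoly-∷ (5 + r) cycleOK k ⟩
  xₚ* (sizePoly (5 + r) (λ x → cycleOK (true ∷ x))) k + sizePoly (5 + r) (λ x → cycleOK (false ∷ x)) k
    ≡⟨ cong₂ _+_ (xₚ*-cong with-0 k) (sizePoly-∷ (4 + r) (λ x → cycleOK (false ∷ x)) k) ⟩
  p₃ + (xₚ* (sizePoly (4 + r) (λ x → cycleOK (false ∷ true ∷ x))) k
        + sizePoly (4 + r) (λ x → cycleOK (false ∷ false ∷ x)) k)
    ≡⟨ cong (p₃ +_) (cong₂ _+_ (xₚ*-cong with-1 k) (without-0-1 k)) ⟩
  p₃ + (p₃ + p₀)
    ≡⟨ cong (p₃ +_) (cong (_+ p₀) (sym (+-identityʳ p₃))) ⟩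
  p₃ + ((p₃ + 0) + p₀)
    ≡⟨ sym (+-assoc p₃ (p₃ + 0) p₀) ⟩
  2 * p₃ + p₀ ∎
  where
  open ≡-Reasoning
  open CycleWords r
  p₃ p₀ : ℕ
  p₃ = xₚ* (ID (path (3 + r))) k
  p₀ = xₚ* (xₚ* (ID (path r))) k

mainTheorem20 : (n : ℕ) → 7 ≤ n →
    ID (cycle n) ≈ₚ ((2 ·ₚ xₚ* (ID (path (n ∸ 3)))) +ₚ xₚ* (xₚ* (ID (path (n ∸ 6)))))
mainTheorem20 (suc (suc (suc (suc (suc (suc (suc r))))))) (s≤s (s≤s (s≤s (s≤s (s≤s (s≤s (s≤s z≤n))))))) =
  cycle-ID (suc r)
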